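{- Fix an integer $k\geq 3$ and let $A_n,\bar A_n$ be the antiregular $k$-hypergraphs defined in the context. Put $j_0=k-1$ and $m_0=k$ if $k$ is odd, and $j_0=k$, $m_0=k-1$ if $k$ is even. (i) Suppose real numbers $\alpha_i^{(m)}$ ($0\le i\le k-1$, $m$ even, $m\ge j_0$) satisfy, for every even $m\geq j_0$, $\alpha_0^{(m)}=\alpha_0^{(m+2)}$, $\alpha_i^{(m)}+\alpha_{i-1}^{(m)}-\alpha_i^{(m+2)}=\binom{m+1}{i-1}$ for $1\le i\le k-1$, and $\alpha_{k-1}^{(m)}=\binom{m}{k-2}$. Then for every integer $n\geq \frac{k+1}{2}$: if $k$ is odd, $$I(A_{2n-1};x)=(1+x)^{n-1-\frac{k-1}{2}}\Big[(1+x)^{k-1}+\sum_{i=0}^{k-1}\alpha_i^{(k-1)}x^i\Big]-\sum_{i=0}^{k-1}\alpha_i^{(2n-2)}x^i+\sum_{i=1}^{k-1}\binom{2n-2}{i-1}x^i,$$ $$I(\bar A_{2n};x)=(1+x)^{n-\frac{k-1}{2}}\Big[(1+x)^{k-1}+\sum_{i=0}^{k-1}\alpha_i^{(k-1)}x^i\Big]-\sum_{i=0}^{k-1}\alpha_i^{(2n)}x^i;$$ if $k$ is even, $$I(A_{2n-1};x)=(1+x)^{n-1-\frac{k}{2}}\Big[(1+x)^{k}+\sum_{i=0}^{k-1}\alpha_i^{(k)}x^i\Big]-\sum_{i=0}^{k-1}\alpha_i^{(2n-2)}x^i+\sum_{i=1}^{k-1}\binom{2n-2}{i-1}x^i,$$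 $$I(\bar A_{2n};x)=(1+x)^{n-\frac{k}{2}}\Big[(1+x)^{k}+\sum_{i=0}^{k-1}\alpha_i^{(k)}x^i\Big]-\sum_{i=0}^{k-1}\alpha_i^{(2n)}x^i.$$ (ii) Suppose real numbers $\beta_i^{(m)}$ ($0\le i\le k-1$, $m$ odd, $m\ge m_0$) satisfy, for every odd $m\ge m_0$, $\beta_0^{(m)}=\beta_0^{(m+2)}$, $\beta_i^{(m)}+\beta_{i-1}^{(m)}-\beta_i^{(m+2)}=\binom{m+1}{i-1}$ for $1\le i\le k-1$, and $\beta_{k-1}^{(m)}=\binom{m}{k-2}$. Then for every integer $n\ge\frac{k+1}{2}$: if $k$ is odd, $$I(\bar A_{2n-1};x)=(1+x)^{n-1-\frac{k-1}{2}}\Big[(1+x)^{k}+\sum_{i=0}^{k-1}\beta_i^{(k)}x^i\Big]-\sum_{i=0}^{k-1}\beta_i^{(2n-1)}x^i,$$ $$I(A_{2n};x)=(1+x)^{n-1-\frac{k-1}{2}}\Big[(1+x)^{k}+\sum_{i=0}^{k-1}\beta_i^{(k)}x^i\Big]-\sum_{i=0}^{k-1}\beta_i^{(2n-1)}x^i+\sum_{i=1}^{k-1}\binom{2n-1}{i-1}x^i;$$ if $k$ is even, $$I(\bar A_{2n-1};x)=(1+x)^{n-\frac{k}{2}}\Big[(1+x)^{k-1}+\sum_{i=0}^{k-1}\beta_i^{(k-1)}x^i\Big]-\sum_{i=0}^{k-1}\beta_i^{(2n-1)}x^i,$$ $$I(A_{2n};x)=(1+x)^{n-\frac{k}{2}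}\Big[(1+x)^{k-1}+\sum_{i=0}^{k-1}\beta_i^{(k-1)}x^i\Big]-\sum_{i=0}^{k-1}\beta_i^{(2n-1)}x^i+\sum_{i=1}^{k-1}\binom{2n-1}{i-1}x^i.$$
   Context: All hypergraphs are $k$-uniform (every hyperedge has exactly $k$ vertices). For a binary string $b=b_1\cdots b_n$, let $H(b)$ be the $k$-uniform hypergraph on $\{1,\dots,n\}$ in which a $k$-subset is a hyperedge iff its largest element $j$ satisfies $b_j=1$ (vertices are added in order; vertex $j$ is isolated if $b_j=0$ and dominating, i.e. forms a hyperedge with every $(k-1)$-subset of earlier vertices, if $b_j=1$). For $1\le n\le k-1$, $A_n=\bar A_n$ is the edgeless hypergraph on $n$ vertices. For $n\ge k$, $A_n=H(b)$ with $b$ of length $n$, $b_1=\dots=b_{k-1}=0$, $b_k,\dots,b_n$ alternating, and $b_n=1$; $\bar A_n$ is the same with $b_n=0$. A vertex set is independent if it contains no hyperedge, and $I(H;x)=\sum_{W\text{ independent}}x^{|W|}$. The superscript $(m)$ on $\alpha,\beta$ is an index, not a power. -}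

module Defs where

open import Level using (Level)
open import Data.Bool using (Bool; true; false; _∧_; _∨_; not; if_then_else_)
open import Data.Nat as ℕ using (ℕ; zero; suc; _∸_; _≤_; _≡ᵇ_; _≤ᵇ_; _%_)
open import Data.Nat.Combinatorics using (_C_)
open import Data.Fin using (Fin; toℕ)
open import Data.Fin.Subset using (Subset; inside; outside; ∣_∣)
open import Data.Fin.Subset.Properties using (_⊆?_)
open import Data.Vec using (Vec; []; _∷_; tabulate)
open import Data.List using (List; []; _∷_; _++_; map; foldr)
open import Relation.Nullary using (does)
open import Relation.Binary.PropositionalEquality using (_≡_)
open import Algebra.Bundles using (CommutativeRing)

-- Hypergraphs on the vertex set Fin n (Fin index i = paper's vertex i+1).
-- A hypergraph is given by the (decidable) characteristic function of its
-- edge set on vertex subsets.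

Hypergraph : ℕ → Set
Hypergraph n = Subset n → Bool

allSubsets : (n : ℕ) → List (Subset n)
allSubsets zero    = [] ∷ []
allSubsets (suc n) = map (outside ∷_) (allSubsets n) ++ map (inside ∷_) (allSubsets n)

nonempty : ∀ {n} → Subset n → Bool
nonempty E = not (∣ E ∣ ≡ᵇ 0)

-- b_j where j is the largest element of E (false if E is empty)
bitAtMax : ∀ {n} → Vec Bool n → Subset n → Bool
bitAtMax []      []      = false
bitAtMax (c ∷ b) (e ∷ E) = if nonempty E then bitAtMax b E else (e ∧ c)

H : (k : ℕ) → ∀ {n} → Vec Bool n → Hypergraph n
H k b E = (∣ E ∣ ≡ᵇ k) ∧ bitAtMax b E

independent : ∀ {n} → Hypergraph n → Subset n → Bool
independent {n} G W = foldr (λ E r → not (does (E ⊆? W) ∧ G E) ∧ r) true (allSubsets n)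

-- For paper vertex j = i+1:
--   A_n   : b_j = 1  iff  j ≥ k and n - j is even  (so b_n = 1)
--   Ā_n   : b_j = 1  iff  j ≥ k and n - j is odd   (so b_n = 0)
-- For n ≤ k-1 there are no k-subsets, so both are edgeless, as in the paper.

bA : (k n : ℕ) → Vec Bool n
bA k n = tabulate (λ i → (k ≤ᵇ suc (toℕ i)) ∧ ((n ∸ suc (toℕ i)) % 2 ≡ᵇ 0))

bĀ : (k n : ℕ) → Vec Bool n
bĀ k n = tabulate (λ i → (k ≤ᵇ suc (toℕ i)) ∧ ((n ∸ suc (toℕ i)) % 2 ≡ᵇ 1))

A : (k n : ℕ) → Hypergraph n
A k n = H k (bA k n)

Ā : (k n : ℕ) → Hypergraph n
Ā k n = H k (bĀ k n)

j₀ : ℕ → ℕ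
j₀ k = if k % 2 ≡ᵇ 1 then k ∸ 1 else k

m₀ : ℕ → ℕ
m₀ k = if k % 2 ≡ᵇ 1 then k else k ∸ 1

module RingDefs {c ℓ : Level} (R : CommutativeRing c ℓ) where
  open CommutativeRing R

  infixr 8 _^_
  _^_ : Carrier → ℕ → Carrier
  x ^ zero    = 1#
  x ^ (suc m) = x * (x ^ m)

  ∑< : ℕ → (ℕ → Carrier) → Carrier
  ∑< zero    f = 0#
  ∑< (suc m) f = ∑< m f + f m

  -- ∑[ a ..  b ] f = f a + ... + f b   (empty if b < a)
  ∑[_‥_] : ℕ → ℕ → (ℕ → Carrier) → Carrier
  ∑[ a ‥ b ] f = ∑< (suc b ∸ a) (λ t → f (a ℕ.+ t))

  ↑ : ℕ → Carrier
  ↑ zero    = 0#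
  ↑ (suc m) = 1# + ↑ m

  I : ∀ {n} → Hypergraph n → Carrier → Carrier
  I {n} G x = go (allSubsets n)
    where
    go : List (Subset n) → Carrier
    go []       = 0#
    go (W ∷ Ws) = (if independent G W then x ^ ∣ W ∣ else 0#) + go Ws

  S : (k : ℕ) → (ℕ → ℕ → Carrier) → ℕ → Carrier → Carrier
  S k γ M x = ∑[ 0 ‥ k ∸ 1 ] (λ i → γ i M * x ^ i)

  T : (k : ℕ) → ℕ → Carrier → Carrier
  T k M x = ∑[ 1 ‥ k ∸ 1 ] (λ i → ↑ (M C (i ∸ 1)) * x ^ i)

  RecFamily : (k p lo : ℕ) → (ℕ → ℕ → Carrier) → Set ℓ
  RecFamily k p lo γ =
    ∀ m → lo ≤ m → m % 2 ≡ p →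
      (γ 0 m ≈ γ 0 (m ℕ.+ 2))
      × ((i : ℕ) → 1 ≤ i → i ≤ k ∸ 1 →
           γ i m + γ (i ∸ 1) m - γ i (m ℕ.+ 2) ≈ ↑ ((m ℕ.+ 1) C (i ∸ 1)))
      × (γ (k ∸ 1) m ≈ ↑ (m C (k ∸ 2)))
    where open import Data.Product using (_×_)

-- Appending a vertex to H(b) multiplies I by 1 + x if the vertex is isolated, and adds
-- T k N x = Σ_{i=1}^{k-1} C(N, i-1) x^i if it is dominating (the new independent sets are W ∪ {v}
-- with |W| ≤ k - 2). Both facts follow by induction on b from the recursion at the first vertex,
-- I(H_k(c ∷ b)) = I(H_k(b)) + x I(H_{k-1}(b)), which holds because W ∪ {first vertex} is
-- independent in H_k(c ∷ b) exactly when W is independent in H_{k-1}(b).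
-- As A_{N+1} is Ā_N plus a dominating vertex (once N + 1 ≥ k) and Ā_{N+1} is A_N plus an
-- isolated one, I(Ā_{m+2}) = (1 + x)(I(Ā_m) + T k m x). The hypotheses on γ say, coefficient by
-- coefficient and via Pascal's rule, that (1 + x)(T k m x - S k γ m x) = - S k γ (m+2) x, so the
-- closed form passes from m to m + 2; it starts at M₀ ∈ {k - 1, k}, where Ā_{M₀} is edgeless.

module Submission where

open import Defs
open import Data.Nat as ℕ using (ℕ; zero; suc; _∸_; _≤_; _<_; _%_; ⌊_/2⌋; _≡ᵇ_; _≤ᵇ_; s≤s; z≤n)
open import Data.Nat.Combinatorics using (_C_; nCk+nC[k+1]≡[n+1]C[k+1])
open import Data.Bool using (Bool; true; false; _∧_; not; if_then_else_)
open import Data.Fin.Subset using (Subset; inside; outside; ∣_∣)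
open import Data.Vec using (Vec; []; _∷_; _∷ʳ_)
open import Data.List using (List; []; _∷_; _++_; map; foldr)
open import Data.Product using (_×_; _,_; proj₁; proj₂)
open import Function using (_∘_)
open import Relation.Binary.PropositionalEquality as ≡ using (_≡_; _≗_)
open import Algebra.Bundles using (CommutativeRing)
import Data.Nat.Properties as ℕₚ
import Algebra.Properties.AbelianGroup as AbelianGroupProperties
import Algebra.Properties.CommutativeSemigroup as CommutativeSemigroupProperties
import Algebra.Properties.Ring as RingProperties
import Algebra.Solver.Ring.NaturalCoefficients.Default as NaturalCoefficientsSolver
import Relation.Binary.Reasoning.Setoid as SetoidReasoning

module IndexArithmetic where
  open import Data.Nat.Properties
    using (+-comm; +-suc; +-∸-assoc; ∸-+-assoc; m+[n∸m]≡n; *-comm; *-cancelʳ-<; ≤-trans)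
  open import Data.Nat.DivMod using ([m+n]%n≡m%n)
  open import Data.Nat.Solver using (module +-*-Solver)
  open ≡ using (refl; sym; trans; cong; subst; subst₂)

  %2-suc-suc : ∀ m → suc (suc m) % 2 ≡ m % 2
  %2-suc-suc m = trans (cong (_% 2) (+-comm 2 m)) ([m+n]%n≡m%n m 2)

  even⇒≡⌊/2⌋*2 : ∀ m → m % 2 ≡ 0 → m ≡ ⌊ m /2⌋ ℕ.* 2
  even⇒≡⌊/2⌋*2 zero          _ = refl
  even⇒≡⌊/2⌋*2 (suc zero)    ()
  even⇒≡⌊/2⌋*2 (suc (suc m)) h = cong (suc ∘ suc) (even⇒≡⌊/2⌋*2 m (trans (sym (%2-suc-suc m)) h))

  odd⇒pred-even : ∀ m → suc m % 2 ≡ 1 → m % 2 ≡ 0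
  odd⇒pred-even zero          _ = refl
  odd⇒pred-even (suc zero)    ()
  odd⇒pred-even (suc (suc m)) h =
    trans (%2-suc-suc m) (odd⇒pred-even m (trans (sym (%2-suc-suc (suc m))) h))

  even≡ᵇ-suc : ∀ m → (suc m % 2 ≡ᵇ 0) ≡ (m % 2 ≡ᵇ 1)
  odd≡ᵇ-suc  : ∀ m → (suc m % 2 ≡ᵇ 1) ≡ (m % 2 ≡ᵇ 0)
  even≡ᵇ-suc zero    = refl
  even≡ᵇ-suc (suc m) = trans (cong (_≡ᵇ 0) (%2-suc-suc m)) (sym (odd≡ᵇ-suc m))
  odd≡ᵇ-suc  zero    = refl
  odd≡ᵇ-suc  (suc m) = trans (cong (_≡ᵇ 1) (%2-suc-suc m)) (sym (even≡ᵇ-suc m))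

  ∸-suc : ∀ {m n} → m < n → n ∸ m ≡ suc (n ∸ suc m)
  ∸-suc {n = suc n} (s≤s m≤n) = +-∸-assoc 1 m≤n

  *2≤⇒< : ∀ {q k n} → q ℕ.* 2 ≤ k → k ℕ.+ 1 ≤ 2 ℕ.* n → q < n
  *2≤⇒< {q} {k} {n} q*2≤k k+1≤2n =
    *-cancelʳ-< 2 q n (≤-trans (s≤s q*2≤k) (subst₂ _≤_ (+-comm k 1) (*-comm 2 n) k+1≤2n))

  2*-split : ∀ {q n} → q < n → 2 ℕ.* n ≡ suc (suc ((n ∸ 1 ∸ q) ℕ.* 2 ℕ.+ q ℕ.* 2))
  2*-split {q} {suc n} (s≤s q≤n) = trans (cong (λ m → 2 ℕ.* suc m) (sym (m+[n∸m]≡n q≤n))) (double q (n ∸ q))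
    where
    open +-*-Solver
    double : ∀ q d → 2 ℕ.* suc (q ℕ.+ d) ≡ suc (suc (d ℕ.* 2 ℕ.+ q ℕ.* 2))
    double = solve 2 (λ q d → con 2 :* (con 1 :+ (q :+ d)) := con 2 :+ (d :* con 2 :+ q :* con 2)) refl

  ⌊/2⌋<n : ∀ M {K} n → M % 2 ≡ 0 → M ≤ K → K ℕ.+ 1 ≤ 2 ℕ.* n → ⌊ M /2⌋ < n
  ⌊/2⌋<n M {K} n even M≤K = *2≤⇒< {n = n} (subst (_≤ K) (even⇒≡⌊/2⌋*2 M even) M≤K)

  ∸-⌊/2⌋ : ∀ M {K} n → M % 2 ≡ 0 → M ≤ K → K ℕ.+ 1 ≤ 2 ℕ.* n →
    n ∸ ⌊ M /2⌋ ≡ suc (n ∸ 1 ∸ ⌊ M /2⌋)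
  ∸-⌊/2⌋ M n even M≤K bound =
    trans (∸-suc (⌊/2⌋<n M n even M≤K bound)) (cong suc (sym (∸-+-assoc n 1 ⌊ M /2⌋)))

  2*-split-even : ∀ M {K} n → M % 2 ≡ 0 → M ≤ K → K ℕ.+ 1 ≤ 2 ℕ.* n →
    2 ℕ.* n ≡ suc (suc ((n ∸ 1 ∸ ⌊ M /2⌋) ℕ.* 2 ℕ.+ M))
  2*-split-even M n even M≤K bound = trans (2*-split (⌊/2⌋<n M n even M≤K bound))
    (cong (λ L → suc (suc ((n ∸ 1 ∸ ⌊ M /2⌋) ℕ.* 2 ℕ.+ L))) (sym (even⇒≡⌊/2⌋*2 M even)))

  2*-split-above : ∀ M {K} n → M % 2 ≡ 0 → M ≤ K → K ℕ.+ 1 ≤ 2 ℕ.* n →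
    2 ℕ.* n ≡ suc ((n ∸ 1 ∸ ⌊ M /2⌋) ℕ.* 2 ℕ.+ suc M)
  2*-split-above M n even M≤K bound =
    trans (2*-split-even M n even M≤K bound) (cong suc (sym (+-suc ((n ∸ 1 ∸ ⌊ M /2⌋) ℕ.* 2) M)))

  2*-split-below : ∀ M {K} n → suc M % 2 ≡ 0 → suc M ≤ K → K ℕ.+ 1 ≤ 2 ℕ.* n →
    2 ℕ.* n ≡ suc ((n ∸ ⌊ suc M /2⌋) ℕ.* 2 ℕ.+ M)
  2*-split-below M n even M≤K bound = trans (2*-split-even (suc M) n even M≤K bound)
    (trans (cong (suc ∘ suc) (+-suc ((n ∸ 1 ∸ ⌊ suc M /2⌋) ℕ.* 2) M))
           (cong (λ e → suc (e ℕ.* 2 ℕ.+ M)) (sym (∸-⌊/2⌋ (suc M) n even M≤K bound))))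

  j₀-odd : ∀ {k} → k % 2 ≡ 1 → j₀ k ≡ k ∸ 1
  j₀-odd {k} odd = cong (λ r → if r ≡ᵇ 1 then k ∸ 1 else k) odd

  j₀-even : ∀ {k} → k % 2 ≡ 0 → j₀ k ≡ k
  j₀-even {k} even = cong (λ r → if r ≡ᵇ 1 then k ∸ 1 else k) even

  m₀-odd : ∀ {k} → k % 2 ≡ 1 → m₀ k ≡ k
  m₀-odd {k} odd = cong (λ r → if r ≡ᵇ 1 then k else k ∸ 1) odd

  m₀-even : ∀ {k} → k % 2 ≡ 0 → m₀ k ≡ k ∸ 1
  m₀-even {k} even = cong (λ r → if r ≡ᵇ 1 then k else k ∸ 1) even

module IndependentSets where
  open import Data.Bool.Properties using (∧-assoc; ∧-identityʳ; ∧-zeroʳ; ∧-conicalˡ)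
  open import Data.Fin.Subset.Properties using (_⊆?_)
  open import Data.List.Properties using (foldr-map; foldr-cong)
  open import Relation.Nullary using (does)
  open ≡ using (refl; sym; trans; cong; cong₂)

  allᵇ : ∀ {A : Set} → (A → Bool) → List A → Bool
  allᵇ p = foldr (λ a r → p a ∧ r) true

  allᵇ-++ : ∀ {A : Set} (p : A → Bool) xs ys → allᵇ p (xs ++ ys) ≡ allᵇ p xs ∧ allᵇ p ys
  allᵇ-++ p []       ys = refl
  allᵇ-++ p (x ∷ xs) ys = trans (cong (p x ∧_) (allᵇ-++ p xs ys)) (sym (∧-assoc (p x) _ _))

  allᵇ-map : ∀ {A B : Set} (p : B → Bool) (f : A → B) xs → allᵇ p (map f xs) ≡ allᵇ (p ∘ f) xs
  allᵇ-map p f = foldr-map (λ a r → p a ∧ r) f true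

  allᵇ-true : ∀ {A : Set} (xs : List A) → allᵇ (λ _ → true) xs ≡ true
  allᵇ-true []       = refl
  allᵇ-true (x ∷ xs) = allᵇ-true xs

  independent-∷ : ∀ {n} (G : Hypergraph (suc n)) e W →
    independent G (e ∷ W) ≡
      allᵇ (λ E → not (does ((outside ∷ E) ⊆? (e ∷ W)) ∧ G (outside ∷ E))) (allSubsets n)
      ∧ allᵇ (λ E → not (does ((inside ∷ E) ⊆? (e ∷ W)) ∧ G (inside ∷ E))) (allSubsets n)
  independent-∷ {n} G e W = begin
    allᵇ p (map (outside ∷_) Ws ++ map (inside ∷_) Ws)       ≡⟨ allᵇ-++ p (map (outside ∷_) Ws) _ ⟩
    allᵇ p (map (outside ∷_) Ws) ∧ allᵇ p (map (inside ∷_) Ws)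
      ≡⟨ cong₂ _∧_ (allᵇ-map p (outside ∷_) Ws) (allᵇ-map p (inside ∷_) Ws) ⟩
    allᵇ (p ∘ (outside ∷_)) Ws ∧ allᵇ (p ∘ (inside ∷_)) Ws ∎
    where
    open ≡.≡-Reasoning
    Ws : List (Subset n)
    Ws = allSubsets n
    p : Subset (suc n) → Bool
    p E = not (does (E ⊆? (e ∷ W)) ∧ G E)

  independent-outside∷ : ∀ {n} (G : Hypergraph (suc n)) W →
    independent G (outside ∷ W) ≡ independent (G ∘ (outside ∷_)) W
  independent-outside∷ {n} G W =
    trans (independent-∷ G outside W)
      (trans (cong (independent (G ∘ (outside ∷_)) W ∧_) (allᵇ-true (allSubsets n))) (∧-identityʳ _))

  independent-inside∷ : ∀ {n} (G : Hypergraph (suc n)) W →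
    independent G (inside ∷ W) ≡ independent (G ∘ (outside ∷_)) W ∧ independent (G ∘ (inside ∷_)) W
  independent-inside∷ G W = independent-∷ G inside W

  independent-cong : ∀ {n} {G G′ : Hypergraph n} → G ≗ G′ → ∀ W → independent G W ≡ independent G′ W
  independent-cong {n} G≗G′ W =
    foldr-cong (λ E r → cong (λ e → not (does (E ⊆? W) ∧ e) ∧ r) (G≗G′ E)) refl (allSubsets n)

  independent-edgeless : ∀ {n} (W : Subset n) → independent (λ _ → false) W ≡ true
  independent-edgeless []            = refl
  independent-edgeless (outside ∷ W) = trans (independent-outside∷ _ W) (independent-edgeless W)
  independent-edgeless (inside ∷ W)  =
    trans (independent-inside∷ _ W) (cong₂ _∧_ (independent-edgeless W) (independent-edgeless W))

  independent-only-∅ : ∀ {n} c (W : Subset n) → independent (λ E → (∣ E ∣ ≡ᵇ 0) ∧ c) W ≡ not c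
  independent-only-∅ c []            = ∧-identityʳ _
  independent-only-∅ c (outside ∷ W) = trans (independent-outside∷ _ W) (independent-only-∅ c W)
  independent-only-∅ c (inside ∷ W)  = begin
    independent G (inside ∷ W)                                 ≡⟨ independent-inside∷ G W ⟩
    independent (G ∘ (outside ∷_)) W ∧ independent (λ _ → false) W
      ≡⟨ cong₂ _∧_ (independent-only-∅ c W) (independent-edgeless W) ⟩
    not c ∧ true                                               ≡⟨ ∧-identityʳ _ ⟩
    not c                                                      ∎
    where
    open ≡.≡-Reasoning
    G : Hypergraph _
    G E = (∣ E ∣ ≡ᵇ 0) ∧ c

  bitAtMax-∅ : ∀ {n} (b : Vec Bool n) E → nonempty E ≡ false → bitAtMax b E ≡ false
  bitAtMax-∅ []      []            _ = refl
  bitAtMax-∅ (c ∷ b) (outside ∷ E) h rewrite h = refl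

  H-outside∷ : ∀ k {n} c (b : Vec Bool n) → H k (c ∷ b) ∘ (outside ∷_) ≗ H k b
  H-outside∷ k c b E with nonempty E in eq
  ... | true  = refl
  ... | false rewrite bitAtMax-∅ b E eq = refl

  H-inside∷ : ∀ k {n} c (b : Vec Bool n) → H (suc (suc k)) (c ∷ b) ∘ (inside ∷_) ≗ H (suc k) b
  H-inside∷ k c b E with ∣ E ∣
  ... | zero  = refl
  ... | suc _ = refl

  H₁-inside∷ : ∀ {n} c (b : Vec Bool n) E → H 1 (c ∷ b) (inside ∷ E) ≡ (∣ E ∣ ≡ᵇ 0) ∧ c
  H₁-inside∷ c b E with ∣ E ∣
  ... | zero  = refl
  ... | suc _ = refl

  independent-H-outside∷ : ∀ k {n} c (b : Vec Bool n) W →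
    independent (H k (c ∷ b)) (outside ∷ W) ≡ independent (H k b) W
  independent-H-outside∷ k c b W = trans (independent-outside∷ _ W) (independent-cong (H-outside∷ k c b) W)

  independent-H-inside∷ : ∀ k {n} c (b : Vec Bool n) W →
    independent (H (suc (suc k)) (c ∷ b)) (inside ∷ W)
      ≡ independent (H (suc (suc k)) b) W ∧ independent (H (suc k) b) W
  independent-H-inside∷ k c b W = trans (independent-inside∷ _ W)
    (cong₂ _∧_ (independent-cong (H-outside∷ (suc (suc k)) c b) W) (independent-cong (H-inside∷ k c b) W))

  independent-H₁-inside∷ : ∀ {n} c (b : Vec Bool n) W →
    independent (H 1 (c ∷ b)) (inside ∷ W) ≡ independent (H 1 b) W ∧ not c
  independent-H₁-inside∷ c b W = trans (independent-inside∷ _ W)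
    (cong₂ _∧_ (independent-cong (H-outside∷ 1 c b) W)
               (trans (independent-cong (H₁-inside∷ c b) W) (independent-only-∅ c W)))

  -- Every (k+2)-edge of H(b) contains a (k+1)-edge of H(b): drop its smallest vertex.
  independent-H-mono : ∀ k {n} (b : Vec Bool n) W →
    independent (H (suc k) b) W ≡ true → independent (H (suc (suc k)) b) W ≡ true
  independent-H-mono k []      []            _ = refl
  independent-H-mono k (c ∷ b) (outside ∷ W) h
    rewrite independent-H-outside∷ (suc (suc k)) c b W | independent-H-outside∷ (suc k) c b W =
    independent-H-mono k b W h
  independent-H-mono zero    (c ∷ b) (inside ∷ W) h =
    trans (independent-H-inside∷ zero c b W) (cong₂ _∧_ (independent-H-mono zero b W smaller) smaller)
    where
    smaller : independent (H 1 b) W ≡ true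
    smaller = ∧-conicalˡ _ _ (trans (sym (independent-H₁-inside∷ c b W)) h)
  independent-H-mono (suc k) (c ∷ b) (inside ∷ W) h =
    trans (independent-H-inside∷ (suc k) c b W) (cong₂ _∧_ (independent-H-mono (suc k) b W smaller) smaller)
    where
    smaller : independent (H (suc (suc k)) b) W ≡ true
    smaller = ∧-conicalˡ _ _ (trans (sym (independent-H-inside∷ k c b W)) h)

  independent-H-link : ∀ k {n} c (b : Vec Bool n) W →
    independent (H (suc (suc k)) (c ∷ b)) (inside ∷ W) ≡ independent (H (suc k) b) W
  independent-H-link k c b W with independent (H (suc k) b) W in eq
  ... | true  = trans (independent-H-inside∷ k c b W) (cong₂ _∧_ (independent-H-mono k b W eq) eq)
  ... | false = trans (independent-H-inside∷ k c b W)
                      (trans (cong (independent (H (suc (suc k)) b) W ∧_) eq) (∧-zeroʳ _))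


module AntiregularStrings where
  open import Data.Nat.Properties using (n∸n≡0; <⇒≱; ≤⇒≤ᵇ; ≤ᵇ⇒≤)
  open import Data.Bool using (T)
  open import Data.Bool.Properties using (∧-identityʳ; ∧-zeroʳ; T-≡)
  open import Data.Fin using (Fin; toℕ; fromℕ; inject₁) renaming (zero to fzero; suc to fsuc)
  open import Data.Fin.Properties using (toℕ-fromℕ; toℕ-inject₁; toℕ<n)
  open import Data.Vec using (tabulate)
  open import Data.Vec.Properties using (tabulate-cong)
  open import Function.Bundles using (Equivalence)
  open import Relation.Nullary using (contradiction)
  open ≡ using (refl; sym; trans; cong; cong₂; subst)
  open IndexArithmetic using (∸-suc; even≡ᵇ-suc; odd≡ᵇ-suc)

  tabulate-∷ʳ : ∀ {A : Set} n (f : Fin (suc n) → A) → tabulate f ≡ tabulate (f ∘ inject₁) ∷ʳ f (fromℕ n)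
  tabulate-∷ʳ zero    f = refl
  tabulate-∷ʳ (suc n) f = cong (f fzero ∷_) (tabulate-∷ʳ n (f ∘ fsuc))

  bA-suc : ∀ k N → bA k (suc N) ≡ bĀ k N ∷ʳ (k ≤ᵇ suc N)
  bA-suc k N = trans (tabulate-∷ʳ N (λ i → (k ≤ᵇ suc (toℕ i)) ∧ ((suc N ∸ suc (toℕ i)) % 2 ≡ᵇ 0)))
    (cong₂ _∷ʳ_ (tabulate-cong flip) last)
    where
    flip : ∀ (i : Fin N) → (k ≤ᵇ suc (toℕ (inject₁ i))) ∧ ((suc N ∸ suc (toℕ (inject₁ i))) % 2 ≡ᵇ 0)
               ≡ (k ≤ᵇ suc (toℕ i)) ∧ ((N ∸ suc (toℕ i)) % 2 ≡ᵇ 1)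
    flip i rewrite toℕ-inject₁ i | ∸-suc (toℕ<n i) =
      cong ((k ≤ᵇ suc (toℕ i)) ∧_) (even≡ᵇ-suc (N ∸ suc (toℕ i)))
    last : (k ≤ᵇ suc (toℕ (fromℕ N))) ∧ ((suc N ∸ suc (toℕ (fromℕ N))) % 2 ≡ᵇ 0) ≡ (k ≤ᵇ suc N)
    last rewrite toℕ-fromℕ N | n∸n≡0 N = ∧-identityʳ _

  bĀ-suc : ∀ k N → bĀ k (suc N) ≡ bA k N ∷ʳ false
  bĀ-suc k N = trans (tabulate-∷ʳ N (λ i → (k ≤ᵇ suc (toℕ i)) ∧ ((suc N ∸ suc (toℕ i)) % 2 ≡ᵇ 1)))
    (cong₂ _∷ʳ_ (tabulate-cong flip) last)
    where
    flip : ∀ (i : Fin N) → (k ≤ᵇ suc (toℕ (inject₁ i))) ∧ ((suc N ∸ suc (toℕ (inject₁ i))) % 2 ≡ᵇ 1)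
               ≡ (k ≤ᵇ suc (toℕ i)) ∧ ((N ∸ suc (toℕ i)) % 2 ≡ᵇ 0)
    flip i rewrite toℕ-inject₁ i | ∸-suc (toℕ<n i) =
      cong ((k ≤ᵇ suc (toℕ i)) ∧_) (odd≡ᵇ-suc (N ∸ suc (toℕ i)))
    last : (k ≤ᵇ suc (toℕ (fromℕ N))) ∧ ((suc N ∸ suc (toℕ (fromℕ N))) % 2 ≡ᵇ 1) ≡ false
    last rewrite toℕ-fromℕ N | n∸n≡0 N = ∧-zeroʳ _

  ≤ᵇ-true : ∀ {m n} → m ≤ n → (m ≤ᵇ n) ≡ true
  ≤ᵇ-true m≤n = Equivalence.to T-≡ (≤⇒≤ᵇ m≤n)

  ≤ᵇ-false : ∀ {m n} → n < m → (m ≤ᵇ n) ≡ false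
  ≤ᵇ-false {m} {n} n<m with m ≤ᵇ n in eq
  ... | false = refl
  ... | true  = contradiction (≤ᵇ⇒≤ m n (subst T (sym eq) _)) (<⇒≱ n<m)


open IndexArithmetic
open IndependentSets
open AntiregularStrings

module Sums {c ℓ} (R : CommutativeRing c ℓ) where
  open CommutativeRing R hiding (zero)
  open RingDefs R
  open AbelianGroupProperties +-abelianGroup using (⁻¹-∙-comm; ε⁻¹≈ε)
  open CommutativeSemigroupProperties +-commutativeSemigroup using (interchange)

  ∑<-front : ∀ n (f : ℕ → Carrier) → ∑< (suc n) f ≈ f 0 + ∑< n (f ∘ suc)
  ∑<-front zero    f = +-comm 0# (f 0)
  ∑<-front (suc n) f = trans (+-congʳ (∑<-front n f)) (+-assoc _ _ _)

  ∑<-cong : ∀ n {f g : ℕ → Carrier} → (∀ i → i < n → f i ≈ g i) → ∑< n f ≈ ∑< n g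
  ∑<-cong zero    f≈g = refl
  ∑<-cong (suc n) f≈g =
    +-cong (∑<-cong n (λ i i<n → f≈g i (ℕₚ.m≤n⇒m≤1+n i<n))) (f≈g n ℕₚ.≤-refl)

  ∑<-+ : ∀ n (f g : ℕ → Carrier) → ∑< n f + ∑< n g ≈ ∑< n (λ i → f i + g i)
  ∑<-+ zero    f g = +-identityʳ 0#
  ∑<-+ (suc n) f g = trans (interchange _ _ _ _) (+-congʳ (∑<-+ n f g))

  ∑<-neg : ∀ n (f : ℕ → Carrier) → - ∑< n f ≈ ∑< n (λ i → - f i)
  ∑<-neg zero    f = ε⁻¹≈ε
  ∑<-neg (suc n) f = trans (sym (⁻¹-∙-comm _ _)) (+-congʳ (∑<-neg n f))

  ↑-+ : ∀ a b → ↑ (a ℕ.+ b) ≈ ↑ a + ↑ b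
  ↑-+ zero    b = sym (+-identityˡ _)
  ↑-+ (suc a) b = trans (+-congˡ (↑-+ a b)) (sym (+-assoc _ _ _))

module Polynomials {c ℓ} (R : CommutativeRing c ℓ) (x : CommutativeRing.Carrier R) where
  open CommutativeRing R hiding (zero)
  open RingDefs R
  open Sums R
  open RingProperties ring using (-‿distribˡ-*)
  open NaturalCoefficientsSolver commutativeSemiring using (solve; _:=_; _:+_; _:*_; con)
  open SetoidReasoning setoid

  poly : (ℕ → Carrier) → ℕ → Carrier
  poly a n = ∑< n (λ i → a i * x ^ i)

  poly-suc : ∀ a n → poly a (suc n) ≈ a 0 * x ^ 0 + ∑< n (λ i → a (suc i) * x ^ suc i)
  poly-suc a n = ∑<-front n (λ i → a i * x ^ i)

  poly-neg : ∀ a n → poly (λ i → - a i) n ≈ - poly a n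
  poly-neg a n = trans (∑<-cong n (λ i _ → sym (-‿distribˡ-* (a i) (x ^ i)))) (sym (∑<-neg n _))

  [1+x]*-expand : ∀ y → (1# + x) * y ≈ y + x * y
  [1+x]*-expand y = trans (distribʳ y 1# x) (+-congʳ (*-identityˡ y))

  [1+x]*poly : ∀ a n → (1# + x) * poly a (suc n)
    ≈ a 0 * x ^ 0 + ∑< n (λ i → (a (suc i) + a i) * x ^ suc i) + a n * x ^ suc n
  [1+x]*poly a zero = solve 3
    (λ z a y → (con 1 :+ z) :* (con 0 :+ a :* y) := a :* y :+ con 0 :+ a :* (z :* y)) refl x (a 0) (x ^ 0)
  [1+x]*poly a (suc n) = begin
    (1# + x) * (poly a (suc n) + a (suc n) * x ^ suc n)
      ≈⟨ distribˡ _ _ _ ⟩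
    (1# + x) * poly a (suc n) + (1# + x) * (a (suc n) * x ^ suc n)
      ≈⟨ +-cong ([1+x]*poly a n) ([1+x]*-expand _) ⟩
    (a 0 * x ^ 0 + Σ + a n * x ^ suc n) + (a (suc n) * x ^ suc n + x * (a (suc n) * x ^ suc n))
      ≈⟨ regroup (a 0 * x ^ 0) Σ (a n) (a (suc n)) (x ^ suc n) x ⟩
    a 0 * x ^ 0 + (Σ + (a (suc n) + a n) * x ^ suc n) + a (suc n) * (x * x ^ suc n) ∎
    where
    Σ : Carrier
    Σ = ∑< n (λ i → (a (suc i) + a i) * x ^ suc i)
    regroup : ∀ u s p q y z → (u + s + p * y) + (q * y + z * (q * y)) ≈ u + (s + (q + p) * y) + q * (z * y)
    regroup = solve 6 (λ u s p q y z →
      (u :+ s :+ p :* y) :+ (q :* y :+ z :* (q :* y)) := u :+ (s :+ (q :+ p) :* y) :+ q :* (z :* y)) refl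

  T-zero : ∀ k → T (suc (suc k)) 0 x ≈ x
  T-zero zero    = solve 1 (λ z → con 0 :+ (con 1 :+ con 0) :* (z :* con 1) := z) refl x
  T-zero (suc k) = trans (+-cong (T-zero k) (zeroˡ _)) (+-identityʳ x)

  T-pascal : ∀ k n → T (suc (suc k)) (suc n) x ≈ T (suc (suc k)) n x + x * T (suc k) n x
  T-pascal zero    n = sym (trans (+-congˡ (zeroʳ x)) (+-identityʳ _))
  T-pascal (suc k) n = begin
    T (suc (suc k)) (suc n) x + ↑ (suc n C suc k) * (x * x ^ suc k)
      ≈⟨ +-cong (T-pascal k n) (*-congʳ ↑-pascal) ⟩
    (T (suc (suc k)) n x + x * T (suc k) n x) + (↑ (n C k) + ↑ (n C suc k)) * (x * x ^ suc k)
      ≈⟨ regroup (T (suc (suc k)) n x) (T (suc k) n x) (↑ (n C k)) (↑ (n C suc k)) x (x ^ suc k) ⟩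
    (T (suc (suc k)) n x + ↑ (n C suc k) * (x * x ^ suc k)) + x * (T (suc k) n x + ↑ (n C k) * x ^ suc k) ∎
    where
    ↑-pascal : ↑ (suc n C suc k) ≈ ↑ (n C k) + ↑ (n C suc k)
    ↑-pascal = trans (reflexive (≡.cong ↑ (≡.sym (nCk+nC[k+1]≡[n+1]C[k+1] n k)))) (↑-+ (n C k) (n C suc k))
    regroup : ∀ a b p q z y → (a + z * b) + (p + q) * (z * y) ≈ (a + q * (z * y)) + z * (b + p * y)
    regroup = solve 6 (λ a b p q z y →
      (a :+ z :* b) :+ (p :+ q) :* (z :* y) := (a :+ q :* (z :* y)) :+ z :* (b :+ p :* y)) refl

module IndependencePolynomials {c ℓ} (R : CommutativeRing c ℓ) (x : CommutativeRing.Carrier R) where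
  open CommutativeRing R hiding (zero)
  open RingDefs R
  open Polynomials R x using ([1+x]*-expand; T-zero; T-pascal)
  open NaturalCoefficientsSolver commutativeSemiring using (solve; _:=_; _:+_; _:*_)
  open import Data.Bool.Properties using (∧-identityʳ; ∧-zeroʳ)
  open import Data.List.Properties using (foldr-universal; foldr-map)
  open SetoidReasoning setoid

  weight : ∀ {n} → Hypergraph n → Subset n → Carrier
  weight G W = if independent G W then x ^ ∣ W ∣ else 0#

  ∑over : ∀ {n} → (Subset n → Carrier) → List (Subset n) → Carrier
  ∑over f = foldr (λ W r → f W + r) 0#

  -- Abstracting `allSubsets n` turns the fold hidden in `I` into a pattern-unification problem.
  I≡∑over : ∀ {n} (G : Hypergraph n) → I G x ≡ ∑over (weight G) (allSubsets n)
  I≡∑over {n} G with allSubsets n | foldr-universal _ (λ W r → weight G W + r) 0# ≡.refl (λ _ _ → ≡.refl)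
  ... | Ws | I≗∑over = I≗∑over Ws

  ∑over-++ : ∀ {n} (f : Subset n → Carrier) xs ys → ∑over f (xs ++ ys) ≈ ∑over f xs + ∑over f ys
  ∑over-++ f []       ys = sym (+-identityˡ _)
  ∑over-++ f (W ∷ xs) ys = trans (+-congˡ (∑over-++ f xs ys)) (sym (+-assoc _ _ _))

  ∑over-cong : ∀ {n} {f g : Subset n → Carrier} xs → (∀ W → f W ≈ g W) → ∑over f xs ≈ ∑over g xs
  ∑over-cong []       f≈g = refl
  ∑over-cong (W ∷ xs) f≈g = +-cong (f≈g W) (∑over-cong xs f≈g)

  ∑over-*ˡ : ∀ {n} a (f : Subset n → Carrier) xs → ∑over (λ W → a * f W) xs ≈ a * ∑over f xs
  ∑over-*ˡ a f []       = sym (zeroʳ a)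
  ∑over-*ˡ a f (W ∷ xs) = trans (+-congˡ (∑over-*ˡ a f xs)) (sym (distribˡ a _ _))

  ∑over-0 : ∀ {n} (xs : List (Subset n)) → ∑over (λ _ → 0#) xs ≈ 0#
  ∑over-0 []       = refl
  ∑over-0 (W ∷ xs) = trans (+-identityˡ _) (∑over-0 xs)

  I-∷ : ∀ {n} (G : Hypergraph (suc n)) →
    I G x ≈ ∑over (weight G ∘ (outside ∷_)) (allSubsets n) + ∑over (weight G ∘ (inside ∷_)) (allSubsets n)
  I-∷ {n} G = begin
    I G x
      ≡⟨ I≡∑over G ⟩
    ∑over (weight G) (map (outside ∷_) Ws ++ map (inside ∷_) Ws)
      ≈⟨ ∑over-++ _ (map (outside ∷_) Ws) _ ⟩
    ∑over (weight G) (map (outside ∷_) Ws) + ∑over (weight G) (map (inside ∷_) Ws)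
      ≡⟨ ≡.cong₂ _+_ (foldr-map _ (outside ∷_) 0# Ws) (foldr-map _ (inside ∷_) 0# Ws) ⟩
    ∑over (weight G ∘ (outside ∷_)) Ws + ∑over (weight G ∘ (inside ∷_)) Ws ∎
    where
    Ws : List (Subset n)
    Ws = allSubsets n

  ∑over-outside : ∀ {n} (G : Hypergraph (suc n)) (G′ : Hypergraph n) →
    (∀ W → independent G (outside ∷ W) ≡ independent G′ W) →
    ∑over (weight G ∘ (outside ∷_)) (allSubsets n) ≈ I G′ x
  ∑over-outside {n} G G′ same = begin
    ∑over (weight G ∘ (outside ∷_)) (allSubsets n)
      ≈⟨ ∑over-cong (allSubsets n)
           (λ W → reflexive (≡.cong (λ e → if e then x ^ ∣ W ∣ else 0#) (same W))) ⟩
    ∑over (weight G′) (allSubsets n) ≡⟨ ≡.sym (I≡∑over G′) ⟩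
    I G′ x                           ∎

  if-*ˡ : ∀ e y → (if e then x * y else 0#) ≈ x * (if e then y else 0#)
  if-*ˡ true  y = refl
  if-*ˡ false y = sym (zeroʳ x)

  ∑over-inside : ∀ {n} (G : Hypergraph (suc n)) (G′ : Hypergraph n) →
    (∀ W → independent G (inside ∷ W) ≡ independent G′ W) →
    ∑over (weight G ∘ (inside ∷_)) (allSubsets n) ≈ x * I G′ x
  ∑over-inside {n} G G′ same = begin
    ∑over (weight G ∘ (inside ∷_)) (allSubsets n)
      ≈⟨ ∑over-cong (allSubsets n) (λ W → trans
           (reflexive (≡.cong (λ e → if e then x * x ^ ∣ W ∣ else 0#) (same W))) (if-*ˡ _ _)) ⟩
    ∑over (λ W → x * weight G′ W) (allSubsets n) ≈⟨ ∑over-*ˡ x (weight G′) (allSubsets n) ⟩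
    x * ∑over (weight G′) (allSubsets n)         ≡⟨ ≡.cong (x *_) (≡.sym (I≡∑over G′)) ⟩
    x * I G′ x                                   ∎

  ∑over-inside-dependent : ∀ {n} (G : Hypergraph (suc n)) →
    (∀ W → independent G (inside ∷ W) ≡ false) → ∑over (weight G ∘ (inside ∷_)) (allSubsets n) ≈ 0#
  ∑over-inside-dependent {n} G never = trans
    (∑over-cong (allSubsets n) (λ W → reflexive (≡.cong (λ e → if e then x * x ^ ∣ W ∣ else 0#) (never W))))
    (∑over-0 (allSubsets n))

  I-H-[] : ∀ k → I (H (suc k) []) x ≈ 1#
  I-H-[] k = +-identityʳ 1#

  I-H-∷ : ∀ k {n} c (b : Vec Bool n) →
    I (H (suc (suc k)) (c ∷ b)) x ≈ I (H (suc (suc k)) b) x + x * I (H (suc k) b) x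
  I-H-∷ k c b = trans (I-∷ (H (suc (suc k)) (c ∷ b)))
    (+-cong (∑over-outside _ _ (independent-H-outside∷ (suc (suc k)) c b))
            (∑over-inside _ _ (independent-H-link k c b)))

  I-H₁-true∷ : ∀ {n} (b : Vec Bool n) → I (H 1 (true ∷ b)) x ≈ I (H 1 b) x
  I-H₁-true∷ b = trans (I-∷ (H 1 (true ∷ b))) (trans
    (+-cong (∑over-outside _ _ (independent-H-outside∷ 1 true b))
            (∑over-inside-dependent _ (λ W → ≡.trans (independent-H₁-inside∷ true b W) (∧-zeroʳ _))))
    (+-identityʳ _))

  I-H₁-false∷ : ∀ {n} (b : Vec Bool n) → I (H 1 (false ∷ b)) x ≈ (1# + x) * I (H 1 b) x
  I-H₁-false∷ b = trans (I-∷ (H 1 (false ∷ b))) (trans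
    (+-cong (∑over-outside _ _ (independent-H-outside∷ 1 false b))
            (∑over-inside _ _ (λ W → ≡.trans (independent-H₁-inside∷ false b W) (∧-identityʳ _))))
    (sym ([1+x]*-expand _)))

  I-H-∷ʳ-isolated : ∀ k {n} (b : Vec Bool n) → I (H (suc k) (b ∷ʳ false)) x ≈ (1# + x) * I (H (suc k) b) x
  I-H-∷ʳ-isolated zero    []          = I-H₁-false∷ []
  I-H-∷ʳ-isolated (suc k) []          = begin
    I (H (suc (suc k)) (false ∷ [])) x                     ≈⟨ I-H-∷ k false [] ⟩
    I (H (suc (suc k)) []) x + x * I (H (suc k) []) x
      ≈⟨ +-congˡ (*-congˡ (trans (I-H-[] k) (sym (I-H-[] (suc k))))) ⟩
    I (H (suc (suc k)) []) x + x * I (H (suc (suc k)) []) x ≈⟨ [1+x]*-expand _ ⟨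
    (1# + x) * I (H (suc (suc k)) []) x                    ∎
  I-H-∷ʳ-isolated zero    (true ∷ b)  = begin
    I (H 1 (true ∷ (b ∷ʳ false))) x ≈⟨ I-H₁-true∷ (b ∷ʳ false) ⟩
    I (H 1 (b ∷ʳ false)) x          ≈⟨ I-H-∷ʳ-isolated zero b ⟩
    (1# + x) * I (H 1 b) x          ≈⟨ *-congˡ (I-H₁-true∷ b) ⟨
    (1# + x) * I (H 1 (true ∷ b)) x ∎
  I-H-∷ʳ-isolated zero    (false ∷ b) = begin
    I (H 1 (false ∷ (b ∷ʳ false))) x  ≈⟨ I-H₁-false∷ (b ∷ʳ false) ⟩
    (1# + x) * I (H 1 (b ∷ʳ false)) x ≈⟨ *-congˡ (I-H-∷ʳ-isolated zero b) ⟩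
    (1# + x) * ((1# + x) * I (H 1 b) x) ≈⟨ *-congˡ (I-H₁-false∷ b) ⟨
    (1# + x) * I (H 1 (false ∷ b)) x  ∎
  I-H-∷ʳ-isolated (suc k) (c ∷ b)     = begin
    I (H (suc (suc k)) (c ∷ (b ∷ʳ false))) x
      ≈⟨ I-H-∷ k c (b ∷ʳ false) ⟩
    I (H (suc (suc k)) (b ∷ʳ false)) x + x * I (H (suc k) (b ∷ʳ false)) x
      ≈⟨ +-cong (I-H-∷ʳ-isolated (suc k) b) (*-congˡ (I-H-∷ʳ-isolated k b)) ⟩
    (1# + x) * I (H (suc (suc k)) b) x + x * ((1# + x) * I (H (suc k) b) x)
      ≈⟨ factor (1# + x) (I (H (suc (suc k)) b) x) (I (H (suc k) b) x) x ⟩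
    (1# + x) * (I (H (suc (suc k)) b) x + x * I (H (suc k) b) x)
      ≈⟨ *-congˡ (I-H-∷ k c b) ⟨
    (1# + x) * I (H (suc (suc k)) (c ∷ b)) x ∎
    where
    factor : ∀ u a b z → u * a + z * (u * b) ≈ u * (a + z * b)
    factor = solve 4 (λ u a b z → u :* a :+ z :* (u :* b) := u :* (a :+ z :* b)) refl

  I-H₁-∷ʳ-dominating : ∀ {n} (b : Vec Bool n) → I (H 1 (b ∷ʳ true)) x ≈ I (H 1 b) x
  I-H₁-∷ʳ-dominating []          = I-H₁-true∷ []
  I-H₁-∷ʳ-dominating (true ∷ b)  = begin
    I (H 1 (true ∷ (b ∷ʳ true))) x ≈⟨ I-H₁-true∷ (b ∷ʳ true) ⟩
    I (H 1 (b ∷ʳ true)) x          ≈⟨ I-H₁-∷ʳ-dominating b ⟩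
    I (H 1 b) x                    ≈⟨ I-H₁-true∷ b ⟨
    I (H 1 (true ∷ b)) x           ∎
  I-H₁-∷ʳ-dominating (false ∷ b) = begin
    I (H 1 (false ∷ (b ∷ʳ true))) x  ≈⟨ I-H₁-false∷ (b ∷ʳ true) ⟩
    (1# + x) * I (H 1 (b ∷ʳ true)) x ≈⟨ *-congˡ (I-H₁-∷ʳ-dominating b) ⟩
    (1# + x) * I (H 1 b) x           ≈⟨ I-H₁-false∷ b ⟨
    I (H 1 (false ∷ b)) x            ∎

  I-H-∷ʳ-dominating : ∀ k {n} (b : Vec Bool n) → I (H (suc k) (b ∷ʳ true)) x ≈ I (H (suc k) b) x + T (suc k) n x
  I-H-∷ʳ-dominating zero    b       = trans (I-H₁-∷ʳ-dominating b) (sym (+-identityʳ _))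
  I-H-∷ʳ-dominating (suc k) []      = begin
    I (H (suc (suc k)) (true ∷ [])) x                ≈⟨ I-H-∷ k true [] ⟩
    I (H (suc (suc k)) []) x + x * I (H (suc k) []) x ≈⟨ +-congˡ (trans (*-congˡ (I-H-[] k)) (*-identityʳ x)) ⟩
    I (H (suc (suc k)) []) x + x                     ≈⟨ +-congˡ (T-zero k) ⟨
    I (H (suc (suc k)) []) x + T (suc (suc k)) 0 x   ∎
  I-H-∷ʳ-dominating (suc k) {suc n} (c ∷ b) = begin
    I (H (suc (suc k)) (c ∷ (b ∷ʳ true))) x
      ≈⟨ I-H-∷ k c (b ∷ʳ true) ⟩
    I (H (suc (suc k)) (b ∷ʳ true)) x + x * I (H (suc k) (b ∷ʳ true)) x
      ≈⟨ +-cong (I-H-∷ʳ-dominating (suc k) b) (*-congˡ (I-H-∷ʳ-dominating k b)) ⟩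
    (I (H (suc (suc k)) b) x + T (suc (suc k)) n x) + x * (I (H (suc k) b) x + T (suc k) n x)
      ≈⟨ regroup (I (H (suc (suc k)) b) x) (T (suc (suc k)) n x) (I (H (suc k) b) x) (T (suc k) n x) x ⟩
    (I (H (suc (suc k)) b) x + x * I (H (suc k) b) x) + (T (suc (suc k)) n x + x * T (suc k) n x)
      ≈⟨ +-cong (I-H-∷ k c b) (T-pascal k n) ⟨
    I (H (suc (suc k)) (c ∷ b)) x + T (suc (suc k)) (suc n) x ∎
    where
    regroup : ∀ a s b t z → (a + s) + z * (b + t) ≈ (a + z * b) + (s + z * t)
    regroup = solve 5 (λ a s b t z → (a :+ s) :+ z :* (b :+ t) := (a :+ z :* b) :+ (s :+ z :* t)) refl

module Antiregular {c ℓ} (R : CommutativeRing c ℓ) (j : ℕ) (x : CommutativeRing.Carrier R) where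
  open CommutativeRing R hiding (zero)
  open RingDefs R
  open Sums R using (∑<-cong; ∑<-+; ∑<-neg; ↑-+)
  open Polynomials R x
  open IndependencePolynomials R x using (I-H-[]; I-H-∷ʳ-isolated; I-H-∷ʳ-dominating)
  open AbelianGroupProperties +-abelianGroup using (⁻¹-∙-comm)
  open CommutativeSemigroupProperties +-commutativeSemigroup using (interchange)
  open RingProperties ring using (-‿distribˡ-*; [y-z]x≈yx-zx)
  open NaturalCoefficientsSolver commutativeSemiring using (solve; _:=_; _:+_; _:*_)
  open import Data.Nat.DivMod using ([m+kn]%n≡m%n; %-pred-≡0)
  open import Data.Sum using (inj₁; inj₂)
  open SetoidReasoning setoid

  k : ℕ
  k = suc (suc j)

  IA IĀ : ℕ → Carrier
  IA  N = I (A k N) x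
  IĀ N = I (Ā k N) x

  IĀ-suc : ∀ N → IĀ (suc N) ≈ (1# + x) * IA N
  IĀ-suc N = trans (reflexive (≡.cong (λ b → I (H k b) x) (bĀ-suc k N))) (I-H-∷ʳ-isolated (suc j) (bA k N))

  IA-suc-isolated : ∀ N → suc N < k → IA (suc N) ≈ (1# + x) * IĀ N
  IA-suc-isolated N lt = trans
    (reflexive (≡.cong (λ b → I (H k b) x) (≡.trans (bA-suc k N) (≡.cong (bĀ k N ∷ʳ_) (≤ᵇ-false lt)))))
    (I-H-∷ʳ-isolated (suc j) (bĀ k N))

  IA-suc-dominating : ∀ N → k ≤ suc N → IA (suc N) ≈ IĀ N + T k N x
  IA-suc-dominating N le = trans
    (reflexive (≡.cong (λ b → I (H k b) x) (≡.trans (bA-suc k N) (≡.cong (bĀ k N ∷ʳ_) (≤ᵇ-true le)))))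
    (I-H-∷ʳ-dominating (suc j) (bĀ k N))

  IA-IĀ-<k : ∀ N → N < k → (IA N ≈ (1# + x) ^ N) × (IĀ N ≈ (1# + x) ^ N)
  IA-IĀ-<k zero    _  = I-H-[] (suc j) , I-H-[] (suc j)
  IA-IĀ-<k (suc N) lt =
    trans (IA-suc-isolated N lt) (*-congˡ (proj₂ below)) , trans (IĀ-suc N) (*-congˡ (proj₁ below))
    where
    below : (IA N ≈ (1# + x) ^ N) × (IĀ N ≈ (1# + x) ^ N)
    below = IA-IĀ-<k N (ℕₚ.<⇒≤ lt)

  IĀ-≤k : ∀ N → N ≤ k → IĀ N ≈ (1# + x) ^ N
  IĀ-≤k N N≤k with ℕₚ.m≤n⇒m<n∨m≡n N≤k
  ... | inj₁ N<k = proj₂ (IA-IĀ-<k N N<k)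
  ... | inj₂ ≡.refl = trans (IĀ-suc (suc j)) (*-congˡ (proj₁ (IA-IĀ-<k (suc j) ℕₚ.≤-refl)))

  T-S-coeff : (ℕ → ℕ → Carrier) → ℕ → ℕ → Carrier
  T-S-coeff γ m zero    = - γ 0 m
  T-S-coeff γ m (suc i) = ↑ (m C i) - γ (suc i) m

  T-S≈poly : ∀ γ m → T k m x - S k γ m x ≈ poly (T-S-coeff γ m) k
  T-S≈poly γ m = begin
    T k m x - S k γ m x
      ≈⟨ +-congˡ (-‿cong (poly-suc (λ i → γ i m) (suc j))) ⟩
    T k m x - (γ 0 m * x ^ 0 + Γ)
      ≈⟨ +-congˡ (sym (⁻¹-∙-comm _ _)) ⟩
    T k m x + (- (γ 0 m * x ^ 0) + - Γ)
      ≈⟨ swap (T k m x) (- (γ 0 m * x ^ 0)) (- Γ) ⟩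
    - (γ 0 m * x ^ 0) + (T k m x - Γ)
      ≈⟨ +-cong (-‿distribˡ-* _ _) T-Γ ⟩
    T-S-coeff γ m 0 * x ^ 0 + ∑< (suc j) (λ i → T-S-coeff γ m (suc i) * x ^ suc i)
      ≈⟨ poly-suc (T-S-coeff γ m) (suc j) ⟨
    poly (T-S-coeff γ m) k ∎
    where
    Γ : Carrier
    Γ = ∑< (suc j) (λ i → γ (suc i) m * x ^ suc i)
    swap : ∀ t u v → t + (u + v) ≈ u + (t + v)
    swap = solve 3 (λ t u v → t :+ (u :+ v) := u :+ (t :+ v)) refl
    T-Γ : T k m x - Γ ≈ ∑< (suc j) (λ i → T-S-coeff γ m (suc i) * x ^ suc i)
    T-Γ = begin
      T k m x - Γ
        ≈⟨ +-congˡ (∑<-neg (suc j) _) ⟩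
      T k m x + ∑< (suc j) (λ i → - (γ (suc i) m * x ^ suc i))
        ≈⟨ ∑<-+ (suc j) _ _ ⟩
      ∑< (suc j) (λ i → ↑ (m C i) * x ^ suc i - γ (suc i) m * x ^ suc i)
        ≈⟨ ∑<-cong (suc j) (λ i _ → sym ([y-z]x≈yx-zx (x ^ suc i) _ _)) ⟩
      ∑< (suc j) (λ i → T-S-coeff γ m (suc i) * x ^ suc i) ∎

  T-S-coeff-pascal : ∀ γ m i →
    T-S-coeff γ m (suc i) + T-S-coeff γ m i ≈ ↑ (suc m C i) - (γ (suc i) m + γ i m)
  T-S-coeff-pascal γ m zero    = trans (+-assoc _ _ _) (+-congˡ (⁻¹-∙-comm _ _))
  T-S-coeff-pascal γ m (suc i) = trans (interchange _ _ _ _) (+-cong pascal (⁻¹-∙-comm _ _))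
    where
    pascal : ↑ (m C suc i) + ↑ (m C i) ≈ ↑ (suc m C suc i)
    pascal = trans (+-comm _ _)
      (trans (sym (↑-+ (m C i) (m C suc i))) (reflexive (≡.cong ↑ (nCk+nC[k+1]≡[n+1]C[k+1] m i))))

  recurrence-step : ∀ (γ : ℕ → ℕ → Carrier) m →
    (γ 0 m ≈ γ 0 (m ℕ.+ 2))
    × (∀ i → 1 ≤ i → i ≤ k ∸ 1 → γ i m + γ (i ∸ 1) m - γ i (m ℕ.+ 2) ≈ ↑ ((m ℕ.+ 1) C (i ∸ 1)))
    × (γ (k ∸ 1) m ≈ ↑ (m C (k ∸ 2))) →
    (1# + x) * (T k m x - S k γ m x) ≈ - S k γ (m ℕ.+ 2) x
  recurrence-step γ m (low , middle , top) = begin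
    (1# + x) * (T k m x - S k γ m x)
      ≈⟨ *-congˡ (T-S≈poly γ m) ⟩
    (1# + x) * poly a k
      ≈⟨ [1+x]*poly a (suc j) ⟩
    a 0 * x ^ 0 + ∑< (suc j) (λ i → (a (suc i) + a i) * x ^ suc i) + a (suc j) * x ^ k
      ≈⟨ +-cong (+-cong (*-congʳ (-‿cong low)) (∑<-cong (suc j) (λ i i<k → *-congʳ (middle′ i i<k))))
                (trans (*-congʳ top′) (zeroˡ _)) ⟩
    - γ′ 0 * x ^ 0 + ∑< (suc j) (λ i → - γ′ (suc i) * x ^ suc i) + 0#
      ≈⟨ trans (+-identityʳ _) (sym (poly-suc (λ i → - γ′ i) (suc j))) ⟩
    poly (λ i → - γ′ i) k
      ≈⟨ poly-neg γ′ k ⟩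
    - S k γ (m ℕ.+ 2) x ∎
    where
    a γ′ : ℕ → Carrier
    a     = T-S-coeff γ m
    γ′ i  = γ i (m ℕ.+ 2)

    middle′ : ∀ i → i < suc j → a (suc i) + a i ≈ - γ′ (suc i)
    middle′ i i<k = begin
      a (suc i) + a i                 ≈⟨ T-S-coeff-pascal γ m i ⟩
      ↑ (suc m C i) - σ               ≈⟨ +-congʳ (sym recurrence) ⟩
      σ - γ′ (suc i) - σ              ≈⟨ +-congʳ (+-comm _ _) ⟩
      - γ′ (suc i) + σ - σ            ≈⟨ +-assoc _ _ _ ⟩
      - γ′ (suc i) + (σ - σ)          ≈⟨ +-congˡ (-‿inverseʳ σ) ⟩
      - γ′ (suc i) + 0#               ≈⟨ +-identityʳ _ ⟩
      - γ′ (suc i)                    ∎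
      where
      σ : Carrier
      σ = γ (suc i) m + γ i m
      recurrence : σ - γ′ (suc i) ≈ ↑ (suc m C i)
      recurrence = trans (middle (suc i) (s≤s z≤n) i<k)
                         (reflexive (≡.cong (λ n → ↑ (n C i)) (ℕₚ.+-comm m 1)))

    top′ : a (suc j) ≈ 0#
    top′ = trans (+-congʳ (sym top)) (-‿inverseʳ _)

  Ā-formula : (ℕ → ℕ → Carrier) → (M₀ e N : ℕ) → Carrier
  Ā-formula γ M₀ e N = (1# + x) ^ e * ((1# + x) ^ M₀ + S k γ M₀ x) - S k γ N x

  module ClosedForm (γ : ℕ → ℕ → Carrier) (p M₀ : ℕ) (family : RecFamily k p M₀ γ)
                    (parity : M₀ % 2 ≡ p) (k∸1≤M₀ : suc j ≤ M₀) (M₀≤k : M₀ ≤ k) where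

    IĀ≈Ā-formula : ∀ e → IĀ (e ℕ.* 2 ℕ.+ M₀) ≈ Ā-formula γ M₀ e (e ℕ.* 2 ℕ.+ M₀)
    IA≈A-formula : ∀ e →
      IA (suc (e ℕ.* 2 ℕ.+ M₀)) ≈ Ā-formula γ M₀ e (e ℕ.* 2 ℕ.+ M₀) + T k (e ℕ.* 2 ℕ.+ M₀) x

    IĀ≈Ā-formula zero = begin
      IĀ M₀                            ≈⟨ IĀ-≤k M₀ M₀≤k ⟩
      (1# + x) ^ M₀                    ≈⟨ +-identityʳ _ ⟨
      (1# + x) ^ M₀ + 0#               ≈⟨ +-congˡ (-‿inverseʳ _) ⟨
      (1# + x) ^ M₀ + (S₀ - S₀)        ≈⟨ +-assoc _ _ _ ⟨
      (1# + x) ^ M₀ + S₀ - S₀          ≈⟨ +-congʳ (*-identityˡ _) ⟨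
      1# * ((1# + x) ^ M₀ + S₀) - S₀   ∎
      where
      S₀ : Carrier
      S₀ = S k γ M₀ x
    IĀ≈Ā-formula (suc e) = begin
      IĀ (suc (suc m))
        ≈⟨ IĀ-suc (suc m) ⟩
      (1# + x) * IA (suc m)
        ≈⟨ *-congˡ (IA≈A-formula e) ⟩
      (1# + x) * ((1# + x) ^ e * B - S k γ m x + T k m x)
        ≈⟨ split (1# + x) ((1# + x) ^ e * B) (- S k γ m x) (T k m x) ⟩
      (1# + x) * ((1# + x) ^ e * B) + (1# + x) * (T k m x - S k γ m x)
        ≈⟨ +-cong (sym (*-assoc _ _ _))
                  (recurrence-step γ m (family m (ℕₚ.m≤n+m M₀ (e ℕ.* 2)) m-parity)) ⟩
      (1# + x) ^ suc e * B - S k γ (m ℕ.+ 2) x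
        ≡⟨ ≡.cong (λ N → (1# + x) ^ suc e * B - S k γ N x) (ℕₚ.+-comm m 2) ⟩
      (1# + x) ^ suc e * B - S k γ (suc (suc m)) x ∎
      where
      m : ℕ
      m = e ℕ.* 2 ℕ.+ M₀
      B : Carrier
      B = (1# + x) ^ M₀ + S k γ M₀ x
      split : ∀ u y s t → u * (y + s + t) ≈ u * y + u * (t + s)
      split = solve 4 (λ u y s t → u :* (y :+ s :+ t) := u :* y :+ u :* (t :+ s)) refl
      m-parity : m % 2 ≡ p
      m-parity = ≡.trans (≡.cong (_% 2) (ℕₚ.+-comm (e ℕ.* 2) M₀)) (≡.trans ([m+kn]%n≡m%n M₀ e 2) parity)

    IA≈A-formula e = trans
      (IA-suc-dominating (e ℕ.* 2 ℕ.+ M₀) (s≤s (ℕₚ.≤-trans k∸1≤M₀ (ℕₚ.m≤n+m M₀ (e ℕ.* 2)))))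
      (+-congʳ (IĀ≈Ā-formula e))

    IA₂ₙ₋₁-IĀ₂ₙ : ∀ n e q → 2 ℕ.* n ≡ suc (suc (e ℕ.* 2 ℕ.+ M₀)) → n ∸ q ≡ suc e →
      (IA (2 ℕ.* n ∸ 1) ≈ Ā-formula γ M₀ e (2 ℕ.* n ∸ 2) + T k (2 ℕ.* n ∸ 2) x)
      × (IĀ (2 ℕ.* n) ≈ Ā-formula γ M₀ (n ∸ q) (2 ℕ.* n))
    IA₂ₙ₋₁-IĀ₂ₙ n e q index exponent rewrite index | exponent = IA≈A-formula e , IĀ≈Ā-formula (suc e)

    IĀ₂ₙ₋₁-IA₂ₙ : ∀ n e → 2 ℕ.* n ≡ suc (e ℕ.* 2 ℕ.+ M₀) →
      (IĀ (2 ℕ.* n ∸ 1) ≈ Ā-formula γ M₀ e (2 ℕ.* n ∸ 1))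
      × (IA (2 ℕ.* n) ≈ Ā-formula γ M₀ e (2 ℕ.* n ∸ 1) + T k (2 ℕ.* n ∸ 1) x)
    IĀ₂ₙ₋₁-IA₂ₙ n e index rewrite index = IĀ≈Ā-formula e , IA≈A-formula e

  part-i-odd : ∀ α → RecFamily k 0 (j₀ k) α → ∀ n → k ℕ.+ 1 ≤ 2 ℕ.* n → k % 2 ≡ 1 →
    (IA (2 ℕ.* n ∸ 1) ≈ Ā-formula α (k ∸ 1) (n ∸ 1 ∸ ⌊ k ∸ 1 /2⌋) (2 ℕ.* n ∸ 2) + T k (2 ℕ.* n ∸ 2) x)
    × (IĀ (2 ℕ.* n) ≈ Ā-formula α (k ∸ 1) (n ∸ ⌊ k ∸ 1 /2⌋) (2 ℕ.* n))
  part-i-odd α family n bound odd =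
    IA₂ₙ₋₁-IĀ₂ₙ n (n ∸ 1 ∸ ⌊ k ∸ 1 /2⌋) ⌊ k ∸ 1 /2⌋
      (2*-split-even (k ∸ 1) n even (ℕₚ.n≤1+n _) bound) (∸-⌊/2⌋ (k ∸ 1) n even (ℕₚ.n≤1+n _) bound)
    where
    even : suc j % 2 ≡ 0
    even = odd⇒pred-even (suc j) odd
    open ClosedForm α 0 (suc j) (≡.subst (λ lo → RecFamily k 0 lo α) (j₀-odd {k} odd) family)
                    even ℕₚ.≤-refl (ℕₚ.n≤1+n _)

  part-i-even : ∀ α → RecFamily k 0 (j₀ k) α → ∀ n → k ℕ.+ 1 ≤ 2 ℕ.* n → k % 2 ≡ 0 →
    (IA (2 ℕ.* n ∸ 1) ≈ Ā-formula α k (n ∸ 1 ∸ ⌊ k /2⌋) (2 ℕ.* n ∸ 2) + T k (2 ℕ.* n ∸ 2) x)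
    × (IĀ (2 ℕ.* n) ≈ Ā-formula α k (n ∸ ⌊ k /2⌋) (2 ℕ.* n))
  part-i-even α family n bound even =
    IA₂ₙ₋₁-IĀ₂ₙ n (n ∸ 1 ∸ ⌊ k /2⌋) ⌊ k /2⌋
      (2*-split-even k n even ℕₚ.≤-refl bound) (∸-⌊/2⌋ k n even ℕₚ.≤-refl bound)
    where
    open ClosedForm α 0 k (≡.subst (λ lo → RecFamily k 0 lo α) (j₀-even {k} even) family)
                    even (ℕₚ.n≤1+n _) ℕₚ.≤-refl

  part-ii-odd : ∀ β → RecFamily k 1 (m₀ k) β → ∀ n → k ℕ.+ 1 ≤ 2 ℕ.* n → k % 2 ≡ 1 →
    (IĀ (2 ℕ.* n ∸ 1) ≈ Ā-formula β k (n ∸ 1 ∸ ⌊ k ∸ 1 /2⌋) (2 ℕ.* n ∸ 1))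
    × (IA (2 ℕ.* n) ≈ Ā-formula β k (n ∸ 1 ∸ ⌊ k ∸ 1 /2⌋) (2 ℕ.* n ∸ 1) + T k (2 ℕ.* n ∸ 1) x)
  part-ii-odd β family n bound odd =
    IĀ₂ₙ₋₁-IA₂ₙ n (n ∸ 1 ∸ ⌊ k ∸ 1 /2⌋)
      (2*-split-above (k ∸ 1) n (odd⇒pred-even (suc j) odd) (ℕₚ.n≤1+n _) bound)
    where
    open ClosedForm β 1 k (≡.subst (λ lo → RecFamily k 1 lo β) (m₀-odd {k} odd) family)
                    odd (ℕₚ.n≤1+n _) ℕₚ.≤-refl

  part-ii-even : ∀ β → RecFamily k 1 (m₀ k) β → ∀ n → k ℕ.+ 1 ≤ 2 ℕ.* n → k % 2 ≡ 0 →
    (IĀ (2 ℕ.* n ∸ 1) ≈ Ā-formula β (k ∸ 1) (n ∸ ⌊ k /2⌋) (2 ℕ.* n ∸ 1))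
    × (IA (2 ℕ.* n) ≈ Ā-formula β (k ∸ 1) (n ∸ ⌊ k /2⌋) (2 ℕ.* n ∸ 1) + T k (2 ℕ.* n ∸ 1) x)
  part-ii-even β family n bound even =
    IĀ₂ₙ₋₁-IA₂ₙ n (n ∸ ⌊ k /2⌋) (2*-split-below (k ∸ 1) n even ℕₚ.≤-refl bound)
    where
    open ClosedForm β 1 (suc j) (≡.subst (λ lo → RecFamily k 1 lo β) (m₀-even {k} even) family)
                    (%-pred-≡0 {suc j} even) ℕₚ.≤-refl (ℕₚ.n≤1+n _)

open Antiregular using (part-i-odd; part-i-even; part-ii-odd; part-ii-even)

theorem2p4 : ∀ {c ℓ} (R : CommutativeRing c ℓ) (k : ℕ) → 3 ≤ k →
  let open CommutativeRing R
      open RingDefs R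
  in
  -- (i)
  ((α : ℕ → ℕ → Carrier) → RecFamily k 0 (j₀ k) α →
    (n : ℕ) → k ℕ.+ 1 ≤ 2 ℕ.* n → (x : Carrier) →
      (k % 2 ≡ 1 →
        (I (A k (2 ℕ.* n ∸ 1)) x
          ≈ (1# + x) ^ (n ∸ 1 ∸ ⌊ k ∸ 1 /2⌋) * ((1# + x) ^ (k ∸ 1) + S k α (k ∸ 1) x)
            - S k α (2 ℕ.* n ∸ 2) x + T k (2 ℕ.* n ∸ 2) x)
        × (I (Ā k (2 ℕ.* n)) x
          ≈ (1# + x) ^ (n ∸ ⌊ k ∸ 1 /2⌋) * ((1# + x) ^ (k ∸ 1) + S k α (k ∸ 1) x)
            - S k α (2 ℕ.* n) x))
      × (k % 2 ≡ 0 →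
        (I (A k (2 ℕ.* n ∸ 1)) x
          ≈ (1# + x) ^ (n ∸ 1 ∸ ⌊ k /2⌋) * ((1# + x) ^ k + S k α k x)
            - S k α (2 ℕ.* n ∸ 2) x + T k (2 ℕ.* n ∸ 2) x)
        × (I (Ā k (2 ℕ.* n)) x
          ≈ (1# + x) ^ (n ∸ ⌊ k /2⌋) * ((1# + x) ^ k + S k α k x)
            - S k α (2 ℕ.* n) x)))
  ×
  -- (ii)
  ((β : ℕ → ℕ → Carrier) → RecFamily k 1 (m₀ k) β →
    (n : ℕ) → k ℕ.+ 1 ≤ 2 ℕ.* n → (x : Carrier) →
      (k % 2 ≡ 1 →
        (I (Ā k (2 ℕ.* n ∸ 1)) x
          ≈ (1# + x) ^ (n ∸ 1 ∸ ⌊ k ∸ 1 /2⌋) * ((1# + x) ^ k + S k β k x)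
            - S k β (2 ℕ.* n ∸ 1) x)
        × (I (A k (2 ℕ.* n)) x
          ≈ (1# + x) ^ (n ∸ 1 ∸ ⌊ k ∸ 1 /2⌋) * ((1# + x) ^ k + S k β k x)
            - S k β (2 ℕ.* n ∸ 1) x + T k (2 ℕ.* n ∸ 1) x))
      × (k % 2 ≡ 0 →
        (I (Ā k (2 ℕ.* n ∸ 1)) x
          ≈ (1# + x) ^ (n ∸ ⌊ k /2⌋) * ((1# + x) ^ (k ∸ 1) + S k β (k ∸ 1) x)
            - S k β (2 ℕ.* n ∸ 1) x)
        × (I (A k (2 ℕ.* n)) x
          ≈ (1# + x) ^ (n ∸ ⌊ k /2⌋) * ((1# + x) ^ (k ∸ 1) + S k β (k ∸ 1) x)
            - S k β (2 ℕ.* n ∸ 1) x + T k (2 ℕ.* n ∸ 1) x)))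
theorem2p4 R (suc (suc j)) _ =
    (λ α family n bound x → part-i-odd R j x α family n bound , part-i-even R j x α family n bound)
  , (λ β family n bound x → part-ii-odd R j x β family n bound , part-ii-even R j x β family n bound)
theorem2p4 R 0 ()
theorem2p4 R 1 (s≤s ())
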